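{- Let $p$ be a natural number whose last decimal digit is $1$, and let $a,b$ be natural numbers. Put $A=a+1$ and $B=b+1$. Suppose that one of the following three cases holds: (i) $p=(10a+7)(10b+3)$, with $A\ge 4$ and $B\ge 8$; (ii) $p=(10a+9)(10b+9)$, with $A\ge 2$ and $B\ge 2$; (iii) $p=(10a+1)(10b+1)$, with $A\ge 10$ and $B\ge 10$. Then $$\frac{p}{100}\le AB\le \frac{121}{10^4}\,p .$$ -}

module Defs where

open import Data.Nat using (ℕ; _+_; _*_; _≤_)
open import Data.Product using (_×_)
open import Data.Sum using (_⊎_)
open import Relation.Binary.PropositionalEquality using (_≡_)

Case : ℕ → ℕ → ℕ → Set
Case p a b =
    (p ≡ (10 * a + 7) * (10 * b + 3) × 4 ≤ a + 1 × 8 ≤ b + 1)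
  ⊎ (p ≡ (10 * a + 9) * (10 * b + 9) × 2 ≤ a + 1 × 2 ≤ b + 1)
  ⊎ (p ≡ (10 * a + 1) * (10 * b + 1) × 10 ≤ a + 1 × 10 ≤ b + 1)

{-# OPTIONS --safe #-}
module Submission where

-- Write each factor as 10a + c with a last digit c ≤ 10. Then 10a + c ≤ 10A, and
-- 10A ≤ (11/10)(10a + c) as soon as 10a + 11c ≥ 100, which is exactly what the lower
-- bounds on A and B guarantee in each of the three cases. Multiplying the two
-- factor estimates gives p ≤ 100AB ≤ (121/100) p.

open import Defs
open import Data.Nat using (ℕ; _+_; _*_; _≤_; _%_; _≤?_)
open import Data.Nat.Properties
  using (≤-refl; +-mono-≤; +-monoʳ-≤; +-cancelʳ-≤; *-mono-≤; *-monoʳ-≤; module ≤-Reasoning)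
open import Data.Nat.Tactic.RingSolver using (solve)
open import Data.List using (_∷_; [])
open import Data.Product using (_×_; _,_)
open import Data.Sum using (inj₁; inj₂)
open import Relation.Nullary.Decidable using (from-yes)
open import Relation.Binary.PropositionalEquality using (_≡_; refl)
open ≤-Reasoning

factor≤10*suc : ∀ a c → c ≤ 10 → 10 * a + c ≤ 10 * (a + 1)
factor≤10*suc a c c≤10 = begin
  10 * a + c                 ≤⟨ +-monoʳ-≤ (10 * a) c≤10 ⟩
  10 * a + 10                ≡⟨ solve (a ∷ []) ⟩
  10 * (a + 1)               ∎

100*suc≤11*factor : ∀ a c → 100 ≤ 10 * a + 11 * c → 100 * (a + 1) ≤ 11 * (10 * a + c)
100*suc≤11*factor a c 100≤ = begin
  100 * (a + 1)              ≡⟨ solve (a ∷ []) ⟩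
  100 * a + 100              ≤⟨ +-monoʳ-≤ (100 * a) 100≤ ⟩
  100 * a + (10 * a + 11 * c) ≡⟨ solve (a ∷ c ∷ []) ⟩
  11 * (10 * a + c)          ∎

digit-threshold : ∀ {k} a c → 110 ≤ 10 * k + 11 * c → k ≤ a + 1 → 100 ≤ 10 * a + 11 * c
digit-threshold {k} a c 110≤ k≤A = +-cancelʳ-≤ 10 100 (10 * a + 11 * c) (begin
  100 + 10                   ≤⟨ 110≤ ⟩
  10 * k + 11 * c            ≤⟨ +-mono-≤ (*-monoʳ-≤ 10 k≤A) ≤-refl ⟩
  10 * (a + 1) + 11 * c      ≡⟨ solve (a ∷ c ∷ []) ⟩
  10 * a + 11 * c + 10       ∎)

product-sandwich : ∀ x y A B → x ≤ 10 * A → y ≤ 10 * B → 100 * A ≤ 11 * x → 100 * B ≤ 11 * y →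
  (x * y ≤ 100 * (A * B)) × (10000 * (A * B) ≤ 121 * (x * y))
product-sandwich x y A B x≤ y≤ ≤x ≤y = upper , lower
  where
  upper : x * y ≤ 100 * (A * B)
  upper = begin
    x * y                    ≤⟨ *-mono-≤ x≤ y≤ ⟩
    (10 * A) * (10 * B)      ≡⟨ solve (A ∷ B ∷ []) ⟩
    100 * (A * B)            ∎
  lower : 10000 * (A * B) ≤ 121 * (x * y)
  lower = begin
    10000 * (A * B)          ≡⟨ solve (A ∷ B ∷ []) ⟩
    (100 * A) * (100 * B)    ≤⟨ *-mono-≤ ≤x ≤y ⟩
    (11 * x) * (11 * y)      ≡⟨ solve (x ∷ y ∷ []) ⟩
    121 * (x * y)            ∎

factors-sandwich : ∀ {k l} a b c d → c ≤ 10 → d ≤ 10 →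
  110 ≤ 10 * k + 11 * c → 110 ≤ 10 * l + 11 * d → k ≤ a + 1 → l ≤ b + 1 →
  ((10 * a + c) * (10 * b + d) ≤ 100 * ((a + 1) * (b + 1)))
  × (10000 * ((a + 1) * (b + 1)) ≤ 121 * ((10 * a + c) * (10 * b + d)))
factors-sandwich a b c d c≤10 d≤10 kc ld k≤A l≤B =
  product-sandwich (10 * a + c) (10 * b + d) (a + 1) (b + 1)
    (factor≤10*suc a c c≤10) (factor≤10*suc b d d≤10)
    (100*suc≤11*factor a c (digit-threshold a c kc k≤A))
    (100*suc≤11*factor b d (digit-threshold b d ld l≤B))

theorem1 : (p a b : ℕ) → p % 10 ≡ 1 → Case p a b →
    (p ≤ 100 * ((a + 1) * (b + 1))) × (10000 * ((a + 1) * (b + 1)) ≤ 121 * p)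
theorem1 p a b _ (inj₁ (refl , 4≤A , 8≤B)) =
  factors-sandwich a b 7 3 (from-yes (7 ≤? 10)) (from-yes (3 ≤? 10))
    (from-yes (110 ≤? 117)) (from-yes (110 ≤? 113)) 4≤A 8≤B
theorem1 p a b _ (inj₂ (inj₁ (refl , 2≤A , 2≤B))) =
  factors-sandwich a b 9 9 (from-yes (9 ≤? 10)) (from-yes (9 ≤? 10))
    (from-yes (110 ≤? 119)) (from-yes (110 ≤? 119)) 2≤A 2≤B
theorem1 p a b _ (inj₂ (inj₂ (refl , 10≤A , 10≤B))) =
  factors-sandwich a b 1 1 (from-yes (1 ≤? 10)) (from-yes (1 ≤? 10))
    (from-yes (110 ≤? 111)) (from-yes (110 ≤? 111)) 10≤A 10≤B
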